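{- For any positive integer $m$, $\frac{s}{\sqrt{4m+1}}\in\mathscr{W}_{m+2}(\sqrt{4m+1})$ for all integers $s$ in $[m,4m+1]$.
   Context: For $s\in\mathbb{N}^+$, $[s]=\{1,\dots,s\}$. For a positive integer $r$ and positive real $\alpha$, $\mathscr{W}_r(\alpha)$ is the smallest set of non-negative real numbers such that: (1) $\alpha\in\mathscr{W}_r(\alpha)$; and (2) for any $s\in\mathbb{N}^+$ and any multi-set $\{q_i: i\in[s]\}$ of positive elements of $\mathscr{W}_r(\alpha)$, if $\beta:=\alpha-\sum_{i=1}^s q_i^{ -1}\ge 0$ and $1\le s\le r-\lceil \beta/(\beta+1)\rceil$, then $\beta\in\mathscr{W}_r(\alpha)$. -}

module Defs where

open import Data.Nat as ℕ using (ℕ; zero; suc; _∸_)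
open import Data.Integer using (+_)
open import Data.Fin using (Fin) renaming (zero to fzero; suc to fsuc)
open import Data.Product using (_×_; _,_; Σ)
open import Data.Sum using (_⊎_)
open import Relation.Binary.PropositionalEquality using (_≡_)
open import Data.Rational as Q using (ℚ; 0ℚ; 1ℚ)

-- Elements of the real subfield ℚ(√D) ⊂ ℝ (D a positive natural number):
-- a pair (a , b) of rationals stands for the real number  a + b·√D,
-- where √D is the positive real square root of D.
Elt : Set
Elt = ℚ × ℚ

module RealQuadratic (D : ℕ) where

  Dℚ : ℚ
  Dℚ = (+ D) Q./ 1

  √D : Elt
  √D = 0ℚ , 1ℚ

  one : Elt
  one = 1ℚ , 0ℚ

  _⊕_ : Elt → Elt → Elt
  (a , b) ⊕ (c , d) = (a Q.+ c) , (b Q.+ d)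

  _⊖_ : Elt → Elt → Elt
  (a , b) ⊖ (c , d) = (a Q.- c) , (b Q.- d)

  _⊗_ : Elt → Elt → Elt
  (a , b) ⊗ (c , d) = (a Q.* c Q.+ b Q.* d Q.* Dℚ) , (a Q.* d Q.+ b Q.* c)

  -- The real number a + b√D equals 0  (exact real-number test, valid also
  -- when D is a perfect square):  a² = b²D and a, b not of the same strict sign.
  IsZero : Elt → Set
  IsZero (a , b) = (a Q.* a ≡ b Q.* b Q.* Dℚ) × (a Q.* b Q.≤ 0ℚ)

  IsPos : Elt → Set
  IsPos (a , b) =
      (0ℚ Q.≤ a × 0ℚ Q.≤ b × (0ℚ Q.< a ⊎ 0ℚ Q.< b))
    ⊎ (0ℚ Q.< a × b Q.< 0ℚ × b Q.* b Q.* Dℚ Q.< a Q.* a)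
    ⊎ (a Q.< 0ℚ × 0ℚ Q.< b × a Q.* a Q.< b Q.* b Q.* Dℚ)

  IsNonNeg : Elt → Set
  IsNonNeg x = IsZero x ⊎ IsPos x

  _≈_ : Elt → Elt → Set
  x ≈ y = IsZero (x ⊖ y)

  sumF : ∀ {s} → (Fin s → Elt) → Elt
  sumF {zero}  f = 0ℚ , 0ℚ
  sumF {suc s} f = f fzero ⊕ sumF (λ i → f (fsuc i))

  -- CeilRatio β c :  c = ⌈β/(β+1)⌉  for a real β ≥ 0
  -- (β/(β+1) ∈ [0,1), so the ceiling is 0 if β = 0 and 1 if β > 0).
  CeilRatio : Elt → ℕ → Set
  CeilRatio β c = (IsZero β × c ≡ 0) ⊎ (IsPos β × c ≡ 1)

  -- 𝒲 r (α) with α = √D, as a predicate on representations, closed under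
  -- equality of the represented reals.  Each step: a multiset {q_i : i ∈ [s]}
  -- of positive elements, inv i is the real number q_i⁻¹ (q_i · inv i = 1),
  -- β = α - Σ q_i⁻¹ ≥ 0 and 1 ≤ s ≤ r - ⌈β/(β+1)⌉.
  data 𝒲 (r : ℕ) : Elt → Set where
    base : ∀ {x} → x ≈ √D → 𝒲 r x
    step : ∀ {x} (s : ℕ) (q inv : Fin s → Elt)
         → (∀ i → 𝒲 r (q i))
         → (∀ i → IsPos (q i))
         → (∀ i → (q i ⊗ inv i) ≈ one)
         → (c : ℕ) → CeilRatio (√D ⊖ sumF inv) c
         → IsNonNeg (√D ⊖ sumF inv)
         → 1 ℕ.≤ s → s ℕ.≤ r ∸ c
         → x ≈ (√D ⊖ sumF inv)
         → 𝒲 r x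

𝒲√ : (D r : ℕ) → Elt → Set
𝒲√ D r = RealQuadratic.𝒲 D r

-- Put D = 4m + 1 and identify b·√D with its coefficient b; the target s/√D is then the
-- coefficient s/D. One closure step applied to a multiset of reached coefficients p/q_i,
-- all with the same numerator p, produces 1 − Σ_i q_i/(pD), so every step reduces to an
-- identity between natural numbers. The coefficients n/D with m ≤ n ≤ D are reached by
-- strong induction on the gap g = D − n:
--   g ≤ m + 1:  g copies of √D itself give 1 − g/D;
--   ratios:     j copies of L/D give (L − j)/L, for 1 ≤ j ≤ m + 1;
--   n ≤ 2m:     n = m + u; take u + 1 copies of (u+1)/(n+1) and m − u copies of 1/2;
--   n > 2m:     take p = ⌈(m+1)(n+1)/g⌉ and m + 1 copies in total of the ratios
--               p/(n+1), p/(n+2), p/(n+3); their reciprocal coefficients add up to g/D.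
module Submission where

open import Defs
open import Data.Nat using (ℕ; zero; suc; _+_; _*_; _∸_; _≤_; _<_; _≤?_; _<?_; s≤s; z≤n; NonZero)
open import Data.Nat.Base using (>-nonZero; >-nonZero⁻¹)
open import Data.Nat.Properties
open import Data.Nat.DivMod using (_%_; m≡m%n+[m/n]*n; m%n<n) renaming (_/_ to _div_)
open import Data.Nat.Induction using (<-rec)
open import Data.Nat.ListAction using (sum)
open import Data.Nat.ListAction.Properties using (sum-++)
open import Data.Nat.Tactic.RingSolver using (solve)
open import Algebra.Properties.CommutativeSemigroup +-commutativeSemigroup using (x∙yz≈y∙xz; xy∙z≈xz∙y)
open import Data.Integer as ℤ using (+_)
import Data.Integer.Properties as ℤ
open import Data.Rational as ℚ using (ℚ; 0ℚ; 1ℚ; _/_)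
import Data.Rational.Properties as ℚ
open import Data.Rational.Unnormalised as ℚᵘ using (mkℚᵘ; *≡*)
import Data.Rational.Unnormalised.Properties as ℚᵘ
open import Algebra.Properties.Group ℚ.+-0-group using (x≈z//y)
open import Data.List using (List; []; _∷_; _++_; replicate; length; lookup; map)
open import Data.List.Properties using (length-++; length-replicate; map-++; map-replicate)
open import Data.Product using (_×_; _,_; ∃₂; proj₁; proj₂)
open import Data.Sum using (inj₁; inj₂)
open import Function using (_∘_)
open import Relation.Binary.PropositionalEquality
open import Relation.Nullary using (yes; no)

toℚᵘ-/ : ∀ a b → ℚ.toℚᵘ (+ a / suc b) ℚᵘ.≃ mkℚᵘ (+ a) b
toℚᵘ-/ a b = ℚ.toℚᵘ-fromℚᵘ (mkℚᵘ (+ a) b)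

/-cross : ∀ a b c d .{{_ : NonZero b}} .{{_ : NonZero d}} →
          a * d ≡ c * b → + a / b ≡ + c / d
/-cross a (suc b) c (suc d) eq = ℚ.toℚᵘ-injective (ℚᵘ.≃-trans (toℚᵘ-/ a b)
  (ℚᵘ.≃-trans (*≡* (trans (sym (ℤ.pos-* a (suc d))) (trans (cong +_ eq) (ℤ.pos-* c (suc b)))))
              (ℚᵘ.≃-sym (toℚᵘ-/ c d))))

/-+-/ : ∀ a b c d .{{_ : NonZero b}} .{{_ : NonZero d}} →
        + a / b ℚ.+ + c / d ≡ _/_ (+ (a * d + c * b)) (b * d) {{m*n≢0 b d}}
/-+-/ a (suc b) c (suc d) = ℚ.toℚᵘ-injective (ℚᵘ.≃-trans (ℚ.toℚᵘ-homo-+ (+ a / suc b) (+ c / suc d))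
  (ℚᵘ.≃-trans (ℚᵘ.+-cong (toℚᵘ-/ a b) (toℚᵘ-/ c d))
  (ℚᵘ.≃-trans (*≡* (cong (ℤ._* + (suc b * suc d)) (sym (trans (ℤ.pos-+ (a * suc d) (c * suc b))
                                                 (cong₂ ℤ._+_ (ℤ.pos-* a (suc d)) (ℤ.pos-* c (suc b)))))))
              (ℚᵘ.≃-sym (toℚᵘ-/ (a * suc d + c * suc b) _)))))

/-*-/ : ∀ a b c d .{{_ : NonZero b}} .{{_ : NonZero d}} →
        (+ a / b) ℚ.* (+ c / d) ≡ _/_ (+ (a * c)) (b * d) {{m*n≢0 b d}}
/-*-/ a (suc b) c (suc d) = ℚ.toℚᵘ-injective (ℚᵘ.≃-trans (ℚ.toℚᵘ-homo-* (+ a / suc b) (+ c / suc d))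
  (ℚᵘ.≃-trans (ℚᵘ.*-cong (toℚᵘ-/ a b) (toℚᵘ-/ c d))
  (ℚᵘ.≃-trans (*≡* (cong (ℤ._* + (suc b * suc d)) (sym (ℤ.pos-* a c))))
              (ℚᵘ.≃-sym (toℚᵘ-/ (a * c) _)))))

/-pos : ∀ a b .{{_ : NonZero b}} → 0 < a → 0ℚ ℚ.< + a / b
/-pos (suc a) b _ = ℚ.positive⁻¹ (+ suc a / b) {{ℚ.normalize-pos (suc a) b}}

0/n≡0 : ∀ n .{{_ : NonZero n}} → + 0 / n ≡ 0ℚ
0/n≡0 n = /-cross 0 n 0 1 refl

n/n≡1 : ∀ n .{{_ : NonZero n}} → + n / n ≡ 1ℚ
n/n≡1 n = /-cross n n 1 1 (sym (*-comm 1 n))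

/-+-/-same : ∀ a c n .{{_ : NonZero n}} → + a / n ℚ.+ + c / n ≡ + (a + c) / n
/-+-/-same a c n = trans (/-+-/ a n c n) (/-cross (a * n + c * n) (n * n) (a + c) n {{m*n≢0 n n}}
  (solve (a ∷ c ∷ n ∷ [])))

/≡1-/ : ∀ t e s n .{{_ : NonZero e}} .{{_ : NonZero n}} →
        t * n + e * s ≡ e * n → + t / e ≡ 1ℚ ℚ.- + s / n
/≡1-/ t e s n eq = x≈z//y (+ t / e) (+ s / n) 1ℚ (trans (/-+-/ t e s n)
  (/-cross (t * n + s * e) (e * n) 1 1 {{m*n≢0 e n}} (begin
    (t * n + s * e) * 1  ≡⟨ solve (t ∷ e ∷ s ∷ n ∷ []) ⟩
    t * n + e * s        ≡⟨ eq ⟩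
    e * n                ≡⟨ solve (e ∷ n ∷ []) ⟩
    1 * (e * n)          ∎)))
  where open ≡-Reasoning

p/q*q/pn*n≡1 : ∀ p q n .{{_ : NonZero q}} .{{_ : NonZero (p * n)}} →
               (+ p / q) ℚ.* (+ q / (p * n)) ℚ.* (+ n / 1) ≡ 1ℚ
p/q*q/pn*n≡1 p q n = begin
  (+ p / q) ℚ.* (+ q / (p * n)) ℚ.* (+ n / 1)             ≡⟨ cong (ℚ._* (+ n / 1)) (/-*-/ p q q (p * n)) ⟩
  _/_ (+ (p * q)) (q * (p * n)) {{qpn≢0}} ℚ.* (+ n / 1)  ≡⟨ /-*-/ (p * q) (q * (p * n)) n 1 {{qpn≢0}} ⟩
  _/_ (+ (p * q * n)) (q * (p * n) * 1) {{qpn1≢0}}        ≡⟨ /-cross (p * q * n) (q * (p * n) * 1) 1 1 {{qpn1≢0}}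
                                                                     (solve (p ∷ q ∷ n ∷ [])) ⟩
  1ℚ                                                      ∎
  where
  open ≡-Reasoning
  qpn≢0 = m*n≢0 q (p * n)
  qpn1≢0 = m*n≢0 (q * (p * n)) 1 {{qpn≢0}}

m+o≡n⇒m≤n : ∀ {m n} o → m + o ≡ n → m ≤ n
m+o≡n⇒m≤n {m} o refl = m≤m+n m o

<⇒≤∸1 : ∀ {m n} → m < n → m ≤ n ∸ 1
<⇒≤∸1 (s≤s m≤n) = m≤n

sum-replicate : ∀ k n → sum (replicate k n) ≡ k * n
sum-replicate zero    n = refl
sum-replicate (suc k) n = cong (_+_ n) (sum-replicate k n)

ceiling-multiple : ∀ X g .{{_ : NonZero g}} → ∃₂ λ p R → R < g × p * g ≡ X + R
ceiling-multiple X (suc g′) =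
  q , g′ ∸ r , s≤s (m∸n≤m g′ r) , +-cancelˡ-≡ r (q * suc g′) (X + (g′ ∸ r)) (begin
    r + q * suc g′      ≡⟨ m≡m%n+[m/n]*n (X + g′) (suc g′) ⟨
    X + g′              ≡⟨ cong (_+_ X) (m+[n∸m]≡n r≤g′) ⟨
    X + (r + (g′ ∸ r))  ≡⟨ x∙yz≈y∙xz X r (g′ ∸ r) ⟩
    r + (X + (g′ ∸ r))  ∎)
  where
  open ≡-Reasoning
  q = (X + g′) div suc g′
  r = (X + g′) % suc g′
  r≤g′ : r ≤ g′
  r≤g′ = ≤-pred (m%n<n (X + g′) (suc g′))

record ThreeLevels (k L S : ℕ) : Set where
  constructor levels
  field
    a b c : ℕ
    count : a + b + c ≡ k
    total : a * L + b * (1 + L) + c * (2 + L) ≡ S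

three-levels : ∀ k L R → R ≤ k + k → ThreeLevels k L (k * L + R)
three-levels zero    L zero          _  = levels 0 0 0 refl refl
three-levels (suc k) L zero          _  = levels (suc k) 0 0 (solve (k ∷ [])) (solve (k ∷ L ∷ []))
three-levels (suc k) L (suc zero)    _  = levels k 1 0 (solve (k ∷ [])) (solve (k ∷ L ∷ []))
three-levels (suc k) L (suc (suc R)) R+2≤2k+2
  with three-levels k L R (≤-pred (subst (suc R ≤_) (+-suc k k) (≤-pred R+2≤2k+2)))
... | levels a b c count total = levels a b (suc c) (trans (+-suc (a + b) c) (cong suc count)) (begin
  a * L + b * (1 + L) + suc c * (2 + L)          ≡⟨ solve (a ∷ b ∷ c ∷ L ∷ []) ⟩
  (a * L + b * (1 + L) + c * (2 + L)) + (2 + L)  ≡⟨ cong (_+ (2 + L)) total ⟩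
  k * L + R + (2 + L)                            ≡⟨ solve (k ∷ L ∷ R ∷ []) ⟩
  suc k * L + suc (suc R)                        ∎)
  where open ≡-Reasoning

record Descent (k L g : ℕ) : Set where
  constructor descent-data
  field
    p j : ℕ
    {{p≢0}} : NonZero p
    p+j≡L : p + j ≡ L
    1≤j : 1 ≤ j
    2+j≤k : 2 + j ≤ k
    split : ThreeLevels k L (p * g)

-- p = ⌈kL/g⌉; the hypotheses bound p between L + 2 − k and L − 1.
descent : ∀ k L g → k < g → g ≤ L → g ≤ 1 + (k + k) → (L + 1) * g < k * (L + g) → Descent k L g
descent k L g k<g g≤L g≤1+2k bound with ceiling-multiple (k * L) g {{>-nonZero (≤-<-trans z≤n k<g)}}
... | p , R , R<g , pg≡kL+R = record
  { p = p ; j = suc j′ ; p≢0 = >-nonZero (≤-trans (s≤s z≤n) 2≤p)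
  ; p+j≡L = p+j≡L
  ; 1≤j = s≤s z≤n
  ; 2+j≤k = +-cancelˡ-≤ p (2 + suc j′) k (subst (_≤ p + k) 2+L≡p+[2+j] 2+L≤p+k)
  ; split = subst (ThreeLevels k L) (sym pg≡kL+R) (three-levels k L R (≤-pred (<-≤-trans R<g g≤1+2k)))
  }
  where
  instance
    g≢0 : NonZero g
    g≢0 = >-nonZero (≤-<-trans z≤n k<g)
  open ≤-Reasoning
  p<L : p < L
  p<L = *-cancelʳ-< g p L (begin-strict
    p * g      ≡⟨ pg≡kL+R ⟩
    k * L + R  <⟨ +-monoʳ-< (k * L) R<g ⟩
    k * L + g  ≤⟨ +-monoʳ-≤ (k * L) g≤L ⟩
    k * L + L  ≡⟨ solve (k ∷ L ∷ []) ⟩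
    L * suc k  ≤⟨ *-monoʳ-≤ L k<g ⟩
    L * g      ∎)
  j′ = proj₁ (m≤n⇒∃[o]m+o≡n p<L)
  p+j≡L : p + suc j′ ≡ L
  p+j≡L = trans (+-suc p j′) (proj₂ (m≤n⇒∃[o]m+o≡n p<L))
  2+L≤p+k : 2 + L ≤ p + k
  2+L≤p+k = subst (_≤ p + k) (cong suc (+-comm L 1)) (*-cancelʳ-< g (L + 1) (p + k) (begin-strict
    (L + 1) * g    <⟨ bound ⟩
    k * (L + g)    ≡⟨ solve (k ∷ L ∷ g ∷ []) ⟩
    k * L + k * g  ≤⟨ +-monoˡ-≤ (k * g) (m+o≡n⇒m≤n R (sym pg≡kL+R)) ⟩
    p * g + k * g  ≡⟨ solve (p ∷ k ∷ g ∷ []) ⟩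
    (p + k) * g    ∎))
  2+L≡p+[2+j] : 2 + L ≡ p + (2 + suc j′)
  2+L≡p+[2+j] = trans (cong (_+_ 2) (sym p+j≡L)) (x∙yz≈y∙xz 2 p (suc j′))
  2≤p : 2 ≤ p
  2≤p = +-cancelʳ-≤ L 2 p (≤-trans 2+L≤p+k (+-monoʳ-≤ p (<⇒≤ (<-≤-trans k<g g≤L))))

-- The cases of the induction on the gap g = D − n.
data Regime (m n g : ℕ) : Set where
  top   : n ≡ 1 + 4 * m → Regime m n g
  near  : 1 ≤ g → g < m + 2 → Regime m n g
  lower : ∀ u w → m ≡ u + w → n ≡ m + u → Regime m n g
  upper : ∀ u w → m ≡ u + w + 2 → n ≡ 1 + m + m + u → Regime m n g

upper-offset : ∀ m u g → 1 + m + m + u + g ≡ 1 + 4 * m → m + 2 ≤ g → u + 2 ≤ m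
upper-offset m u g n+g≡D m+2≤g = +-cancelˡ-≤ (1 + 3 * m) (u + 2) m (begin
  1 + 3 * m + (u + 2)      ≡⟨ solve (m ∷ u ∷ []) ⟩
  1 + m + m + u + (m + 2)  ≤⟨ +-monoʳ-≤ (1 + m + m + u) m+2≤g ⟩
  1 + m + m + u + g        ≡⟨ n+g≡D ⟩
  1 + 4 * m                ≡⟨ solve (m ∷ []) ⟩
  1 + 3 * m + m            ∎)
  where open ≤-Reasoning

regime : ∀ m n g → m ≤ n → n + g ≡ 1 + 4 * m → Regime m n g
regime m n zero _ n+0≡D = top (trans (sym (+-identityʳ n)) n+0≡D)
regime m n (suc g) m≤n n+g≡D with suc g <? m + 2 | n ≤? m + m
... | yes g<r | _ = near (s≤s z≤n) g<r
... | no g≮r | yes n≤2m with m≤n⇒∃[o]m+o≡n m≤n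
...   | u , refl with m≤n⇒∃[o]m+o≡n (+-cancelˡ-≤ m u m n≤2m)
...     | w , refl = lower u w refl refl
regime m n (suc g) m≤n n+g≡D | no g≮r | no n≰2m with m≤n⇒∃[o]m+o≡n (≰⇒> n≰2m)
...   | u , refl with m≤n⇒∃[o]m+o≡n (upper-offset m u (suc g) n+g≡D (≮⇒≥ g≮r))
...     | w , refl = upper u w (xy∙z≈xz∙y u 2 w) refl

module Closure (D : ℕ) .{{_ : NonZero D}} (r : ℕ) where

  open RealQuadratic D

  ≈-refl : ∀ x → x ≈ x
  ≈-refl (a , b) = subst IsZero (sym (cong₂ _,_ (ℚ.+-inverseʳ a) (ℚ.+-inverseʳ b)))
    (trans (ℚ.*-zeroˡ 0ℚ) (sym (trans (cong (ℚ._* Dℚ) (ℚ.*-zeroˡ 0ℚ)) (ℚ.*-zeroˡ Dℚ))) ,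
     ℚ.≤-reflexive (ℚ.*-zeroˡ 0ℚ))

  ≡⇒≈ : ∀ {x y} → x ≡ y → x ≈ y
  ≡⇒≈ {x} refl = ≈-refl x

  multiple-pos : ∀ {b} → 0ℚ ℚ.< b → IsPos (0ℚ , b)
  multiple-pos 0<b = inj₁ (ℚ.≤-refl , ℚ.<⇒≤ 0<b , inj₂ 0<b)

  Reach : ℚ → Set
  Reach b = 𝒲 r (0ℚ , b)

  record Part (p : ℕ) : Set where
    constructor part
    field
      q : ℕ
      .{{q≢0}} : NonZero q
      reached : Reach (+ p / q)

  open Part

  -- A multiset of parts is a list of (multiplicity , part).
  module _ (p : ℕ) .{{_ : NonZero p}} where

    instance
      pD≢0 : NonZero (p * D)
      pD≢0 = m*n≢0 p D

    size weight : List (ℕ × Part p) → ℕ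
    size ms = sum (map proj₁ ms)
    weight ms = sum (map (λ (k , x) → k * q x) ms)

    expand : List (ℕ × Part p) → List (Part p)
    expand [] = []
    expand ((k , x) ∷ ms) = replicate k x ++ expand ms

    Σq : List (Part p) → ℕ
    Σq xs = sum (map q xs)

    length-expand : ∀ ms → length (expand ms) ≡ size ms
    length-expand [] = refl
    length-expand ((k , x) ∷ ms) =
      trans (length-++ (replicate k x)) (cong₂ _+_ (length-replicate k) (length-expand ms))

    Σq-expand : ∀ ms → Σq (expand ms) ≡ weight ms
    Σq-expand [] = refl
    Σq-expand ((k , x) ∷ ms) = begin
      sum (map q (replicate k x ++ expand ms))          ≡⟨ cong sum (map-++ q (replicate k x) (expand ms)) ⟩
      sum (map q (replicate k x) ++ map q (expand ms))  ≡⟨ sum-++ (map q (replicate k x)) _ ⟩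
      sum (map q (replicate k x)) + Σq (expand ms)      ≡⟨ cong₂ _+_ replicated (Σq-expand ms) ⟩
      k * q x + weight ms                               ∎
      where
      open ≡-Reasoning
      replicated = trans (cong sum (map-replicate q k x)) (sum-replicate k (q x))

    element reciprocal : Part p → Elt
    element x = 0ℚ , + p / q x
    reciprocal x = 0ℚ , + q x / (p * D)

    element-pos : ∀ x → IsPos (element x)
    element-pos x = multiple-pos (/-pos p (q x) (>-nonZero⁻¹ p))

    element⊗reciprocal : ∀ x → (element x ⊗ reciprocal x) ≈ one
    element⊗reciprocal x = ≡⇒≈ (cong₂ _,_
      (trans (cong (ℚ._+ (b ℚ.* v ℚ.* Dℚ)) (ℚ.*-zeroˡ 0ℚ))
             (trans (ℚ.+-identityˡ _) (p/q*q/pn*n≡1 p (q x) D)))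
      (trans (cong₂ ℚ._+_ (ℚ.*-zeroˡ v) (ℚ.*-zeroʳ b)) (ℚ.+-identityˡ 0ℚ)))
      where
      b = + p / q x
      v = + q x / (p * D)

    sumF-reciprocal : ∀ xs → sumF (reciprocal ∘ lookup xs) ≡ (0ℚ , + Σq xs / (p * D))
    sumF-reciprocal [] = cong (0ℚ ,_) (sym (0/n≡0 (p * D)))
    sumF-reciprocal (x ∷ xs) = begin
      reciprocal x ⊕ sumF (reciprocal ∘ lookup xs)         ≡⟨ cong (reciprocal x ⊕_) (sumF-reciprocal xs) ⟩
      (0ℚ ℚ.+ 0ℚ , + q x / (p * D) ℚ.+ + Σq xs / (p * D))  ≡⟨ cong₂ _,_ (ℚ.+-identityˡ 0ℚ)
                                                                        (/-+-/-same (q x) (Σq xs) (p * D)) ⟩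
      (0ℚ , + Σq (x ∷ xs) / (p * D))                        ∎
      where open ≡-Reasoning

    -- The balance equation says t/e = 1 − weight/(pD), the coefficient of β.
    reach-step : (ms : List (ℕ × Part p)) → 1 ≤ size ms → size ms < r →
                 ∀ t e .{{_ : NonZero e}} → 0 < t → t * (p * D) + e * weight ms ≡ e * (p * D) →
                 Reach (+ t / e)
    reach-step ms 1≤size size<r t e 0<t balance =
      𝒲.step (length xs) (element ∘ lookup xs) (reciprocal ∘ lookup xs)
        (reached ∘ lookup xs) (element-pos ∘ lookup xs) (element⊗reciprocal ∘ lookup xs)
        1 (inj₂ (β-pos , refl)) (inj₂ β-pos)
        (subst (1 ≤_) (sym (length-expand ms)) 1≤size)
        (subst (_≤ r ∸ 1) (sym (length-expand ms)) (<⇒≤∸1 size<r))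
        (≡⇒≈ (sym β≡))
      where
      xs = expand ms
      β≡ : √D ⊖ sumF (reciprocal ∘ lookup xs) ≡ (0ℚ , + t / e)
      β≡ = begin
        √D ⊖ sumF (reciprocal ∘ lookup xs)      ≡⟨ cong (√D ⊖_) (sumF-reciprocal xs) ⟩
        (0ℚ ℚ.- 0ℚ , 1ℚ ℚ.- + Σq xs / (p * D))  ≡⟨ cong₂ _,_ (ℚ.+-inverseʳ 0ℚ) (sym (/≡1-/ t e (Σq xs) (p * D)
                                                     (trans (cong (λ w → t * (p * D) + e * w) (Σq-expand ms)) balance))) ⟩
        (0ℚ , + t / e)                          ∎
        where open ≡-Reasoning
      β-pos : IsPos (√D ⊖ sumF (reciprocal ∘ lookup xs))
      β-pos = subst IsPos (sym β≡) (multiple-pos (/-pos t e 0<t))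

  reach-one : Reach 1ℚ
  reach-one = 𝒲.base (≈-refl √D)

  reach-cross : ∀ a b c d .{{_ : NonZero b}} .{{_ : NonZero d}} →
                a * d ≡ c * b → Reach (+ a / b) → Reach (+ c / d)
  reach-cross a b c d eq = subst Reach (/-cross a b c d eq)

  reach-ratio : ∀ L .{{_ : NonZero L}} j t → 1 ≤ j → j < r → 0 < t → t + j ≡ L →
                Reach (+ L / D) → Reach (+ t / L)
  reach-ratio L j t 1≤j j<r 0<t t+j≡L hL =
    reach-step L ((j , part D hL) ∷ []) (subst (1 ≤_) (sym (+-identityʳ j)) 1≤j)
      (subst (_< r) (sym (+-identityʳ j)) j<r) t L 0<t (begin
        t * (L * D) + L * (j * D + 0)  ≡⟨ solve (t ∷ j ∷ L ∷ D ∷ []) ⟩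
        (t + j) * (L * D)              ≡⟨ cong (_* (L * D)) t+j≡L ⟩
        L * (L * D)                    ∎)
    where open ≡-Reasoning

  reach-descent : ∀ {k L g} .{{_ : NonZero L}} → Descent k L g → k < r → ∀ n → 0 < n → n + g ≡ D →
                  Reach (+ L / D) → Reach (+ (1 + L) / D) → Reach (+ (2 + L) / D) → Reach (+ n / D)
  reach-descent {k} {L} {g} (descent-data p j {{p≢0}} p+j≡L 1≤j 2+j≤k (levels a b c count total))
                k<r n 0<n n+g≡D h₀ h₁ h₂ =
    reach-step p ms 1≤size size<r n D 0<n balance
    where
    open ≡-Reasoning
    2+j<r : 2 + j < r
    2+j<r = ≤-<-trans 2+j≤k k<r
    0<p : 0 < p
    0<p = >-nonZero⁻¹ p
    p+[1+j]≡1+L : p + (1 + j) ≡ 1 + L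
    p+[1+j]≡1+L = trans (+-suc p j) (cong suc p+j≡L)
    p+[2+j]≡2+L : p + (2 + j) ≡ 2 + L
    p+[2+j]≡2+L = trans (+-suc p (1 + j)) (cong suc p+[1+j]≡1+L)
    ms : List (ℕ × Part p)
    ms = (a , part L (reach-ratio L j p 1≤j (≤-<-trans (m≤n+m j 2) 2+j<r) 0<p p+j≡L h₀))
       ∷ (b , part (1 + L) (reach-ratio (1 + L) (1 + j) p (s≤s z≤n) (≤-<-trans (n≤1+n (1 + j)) 2+j<r)
                                        0<p p+[1+j]≡1+L h₁))
       ∷ (c , part (2 + L) (reach-ratio (2 + L) (2 + j) p (s≤s z≤n) 2+j<r 0<p p+[2+j]≡2+L h₂))
       ∷ []
    size≡k : size p ms ≡ k
    size≡k = begin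
      a + (b + (c + 0))  ≡⟨ solve (a ∷ b ∷ c ∷ []) ⟩
      a + b + c          ≡⟨ count ⟩
      k                  ∎
    1≤size : 1 ≤ size p ms
    1≤size = subst (1 ≤_) (sym size≡k) (≤-trans (s≤s z≤n) 2+j≤k)
    size<r : size p ms < r
    size<r = subst (_< r) (sym size≡k) k<r
    balance : n * (p * D) + D * weight p ms ≡ D * (p * D)
    balance = begin
      n * (p * D) + D * (a * L + (b * (1 + L) + (c * (2 + L) + 0)))
        ≡⟨ solve (n ∷ p ∷ D ∷ a ∷ b ∷ c ∷ L ∷ []) ⟩
      n * (p * D) + D * (a * L + b * (1 + L) + c * (2 + L))
        ≡⟨ cong (λ w → n * (p * D) + D * w) total ⟩
      n * (p * D) + D * (p * g)  ≡⟨ solve (n ∷ p ∷ g ∷ D ∷ []) ⟩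
      (n + g) * (p * D)          ≡⟨ cong (_* (p * D)) n+g≡D ⟩
      D * (p * D)                ∎

module Targets (m : ℕ) (1≤m : 1 ≤ m) where

  open Closure (1 + 4 * m) (m + 2)

  Reach/√D : ℕ → Set
  Reach/√D n = Reach (+ n / (1 + 4 * m))

  Above : ℕ → Set
  Above n = ∀ x → n < x → x ≤ 1 + 4 * m → Reach/√D x

  reach-√D : Reach/√D (1 + 4 * m)
  reach-√D = subst Reach (sym (n/n≡1 (1 + 4 * m))) reach-one

  m<r : m < m + 2
  m<r = m+o≡n⇒m≤n 1 (solve (m ∷ []))

  1+m<r : 1 + m < m + 2
  1+m<r = ≤-reflexive (+-comm 2 m)

  2+2m≤D : 1 + m + (1 + m) ≤ 1 + 4 * m
  2+2m≤D = begin
    1 + m + (1 + m)  ≡⟨ solve (m ∷ []) ⟩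
    1 + m + m + 1    ≤⟨ +-monoʳ-≤ (1 + m + m) 1≤m ⟩
    1 + m + m + m    ≤⟨ m+o≡n⇒m≤n m (solve (m ∷ [])) ⟩
    1 + 4 * m        ∎
    where open ≤-Reasoning

  reach-lower : ∀ u w → m ≡ u + w → Above (m + u) → Reach/√D (m + u)
  reach-lower u w refl above =
    reach-step (1 + u) ms (s≤s z≤n) (m+o≡n⇒m≤n 0 size≡) (m + u) (1 + 4 * m) (≤-trans 1≤m (m≤m+n m u)) balance
    where
    half : Reach (+ (1 + u) / (1 + u + (1 + u)))
    half = reach-cross (1 + m) (1 + m + (1 + m)) (1 + u) (1 + u + (1 + u)) (solve (u ∷ w ∷ []))
             (reach-ratio (1 + m + (1 + m)) (1 + m) (1 + m) (s≤s z≤n) 1+m<r (s≤s z≤n) refl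
               (above (1 + m + (1 + m)) (m+o≡n⇒m≤n (1 + w) (solve (u ∷ w ∷ []))) 2+2m≤D))
    ratio : Reach (+ (1 + u) / (1 + (m + u)))
    ratio = reach-ratio (1 + (m + u)) m (1 + u) 1≤m m<r (s≤s z≤n) (solve (u ∷ w ∷ []))
              (above (1 + (m + u)) ≤-refl (m+o≡n⇒m≤n (2 * u + 3 * w) (solve (u ∷ w ∷ []))))
    ms : List (ℕ × Part (1 + u))
    ms = (1 + u , part (1 + (m + u)) ratio) ∷ (w , part (1 + u + (1 + u)) half) ∷ []
    size≡ : 1 + (1 + u + (w + 0)) + 0 ≡ m + 2
    size≡ = solve (u ∷ w ∷ [])
    balance : (m + u) * ((1 + u) * (1 + 4 * m))
              + (1 + 4 * m) * ((1 + u) * (1 + (m + u)) + (w * (1 + u + (1 + u)) + 0))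
              ≡ (1 + 4 * m) * ((1 + u) * (1 + 4 * m))
    balance = solve (u ∷ w ∷ [])

  reach-upper : ∀ u w → m ≡ u + w + 2 → Above (1 + m + m + u) → Reach/√D (1 + m + m + u)
  reach-upper u w refl above =
    reach-descent (descent (1 + m) (2 + m + m + u) (u + 2 * w + 4)
                     (m+o≡n⇒m≤n w (solve (u ∷ w ∷ [])))
                     (m+o≡n⇒m≤n (2 * u + 2) (solve (u ∷ w ∷ [])))
                     (m+o≡n⇒m≤n (u + 3) (solve (u ∷ w ∷ [])))
                     (m+o≡n⇒m≤n (u * u + 3 * u + 1) (solve (u ∷ w ∷ []))))
      1+m<r (1 + m + m + u) (s≤s z≤n) (solve (u ∷ w ∷ []))
      (above (2 + m + m + u) (n<1+n _) (m+o≡n⇒m≤n (u + 2 * w + 3) (solve (u ∷ w ∷ []))))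
      (above (3 + m + m + u) (m<n⇒m<1+n (n<1+n _)) (m+o≡n⇒m≤n (u + 2 * w + 2) (solve (u ∷ w ∷ []))))
      (above (4 + m + m + u) (m<n⇒m<1+n (m<n⇒m<1+n (n<1+n _))) (m+o≡n⇒m≤n (u + 2 * w + 1) (solve (u ∷ w ∷ []))))

  ReachAtGap : ℕ → Set
  ReachAtGap g = ∀ n → m ≤ n → n + g ≡ 1 + 4 * m → Reach/√D n

  above-gap : ∀ {g n} → (∀ {g′} → g′ < g → ReachAtGap g′) → m ≤ n → n + g ≡ 1 + 4 * m → Above n
  above-gap {g} {n} ih m≤n n+g≡D x n<x x≤D with m≤n⇒∃[o]m+o≡n x≤D
  ... | g′ , x+g′≡D = ih (+-cancelˡ-< n g′ g (begin-strict
        n + g′     <⟨ +-monoˡ-< g′ n<x ⟩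
        x + g′     ≡⟨ x+g′≡D ⟩
        1 + 4 * m  ≡⟨ n+g≡D ⟨
        n + g      ∎)) x (≤-trans m≤n (<⇒≤ n<x)) x+g′≡D
    where open ≤-Reasoning

  reach-gap : ∀ g → (∀ {g′} → g′ < g → ReachAtGap g′) → ReachAtGap g
  reach-gap g ih n m≤n n+g≡D with regime m n g m≤n n+g≡D
  ... | top refl          = reach-√D
  ... | near 1≤g g<r      = reach-ratio (1 + 4 * m) g n 1≤g g<r (≤-trans 1≤m m≤n) n+g≡D reach-√D
  ... | lower u w m≡ refl = reach-lower u w m≡ (above-gap ih m≤n n+g≡D)
  ... | upper u w m≡ refl = reach-upper u w m≡ (above-gap ih m≤n n+g≡D)

  reach-all : ∀ n → m ≤ n → n ≤ 1 + 4 * m → Reach/√D n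
  reach-all n m≤n n≤D = <-rec ReachAtGap reach-gap (proj₁ gap) n m≤n (proj₂ gap)
    where gap = m≤n⇒∃[o]m+o≡n n≤D

proposition4p3 : (m : ℕ) → 1 ≤ m → (s : ℕ) → m ≤ s → s ≤ 1 + 4 * m →
    𝒲√ (1 + 4 * m) (m + 2) (0ℚ , ((+ s) / (1 + 4 * m)))
proposition4p3 m 1≤m = Targets.reach-all m 1≤m
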